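{- Let $n>8$ and let $G$ be a divisible design graph with parameters $(4n,n+2,n-2,2,4,n)$. Then the classes of its canonical partition can be numbered so that its quotient matrix $R$ equals one of the following three matrices: $$\begin{pmatrix} n-1&1&1&1\\ 1&n-1&1&1\\ 1&1&n-1&1\\ 1&1&1&n-1\end{pmatrix},\quad \begin{pmatrix} 1&n-1&1&1\\ n-1&1&1&1\\ 1&1&n-1&1\\ 1&1&1&n-1\end{pmatrix},\quad \begin{pmatrix} 1&n-1&1&1\\ n-1&1&1&1\\ 1&1&1&n-1\\ 1&1&n-1&1\end{pmatrix}.$$
   Context: A divisible design graph (DDG) with parameters $(v,k,\lambda_1,\lambda_2,m,n)$ is a $k$-regular graph on $v=mn$ vertices whose vertex set can be partitioned into $m$ classes of size $n$ (a canonical partition) such that any two distinct vertices in the same class have exactly $\lambda_1$ common neighbours and any two vertices in different classes have exactly $\lambda_2$ common neighbours. For $\lambda_1\neq\lambda_2$ the canonical partition is equitable: each vertex of class $V_i$ has the same number $r_{ij}$ of neighbours in class $V_j$; $R=(r_{ij})$ is the quotient matrix. -}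

module Defs where

open import Data.Nat using (ℕ; zero; suc; _+_; _*_; _∸_)
open import Data.Fin using (Fin; zero; suc)
open import Data.Bool using (Bool; true; false; _∧_)
open import Relation.Binary.PropositionalEquality using (_≡_; _≢_)
open import Data.Product using (_×_)
open import Data.Fin.Permutation using (Permutation′; _⟨$⟩ʳ_)

count : ∀ {v} → (Fin v → Bool) → ℕ
count {zero}  P = 0
count {suc v} P with P zero
... | true  = suc (count (λ i → P (suc i)))
... | false = count (λ i → P (suc i))

_==_ : ∀ {m} → Fin m → Fin m → Bool
zero  == zero  = true
zero  == suc _ = false
suc _ == zero  = false
suc i == suc j = i == j

record SimpleGraph (v : ℕ) : Set where
  field
    adj   : Fin v → Fin v → Bool
    sym   : ∀ x y → adj x y ≡ adj y x
    irrfl : ∀ x → adj x x ≡ false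

open SimpleGraph public

degree : ∀ {v} → SimpleGraph v → Fin v → ℕ
degree G x = count (λ y → adj G x y)

commonNbrs : ∀ {v} → SimpleGraph v → Fin v → Fin v → ℕ
commonNbrs G x y = count (λ z → adj G x z ∧ adj G y z)

record IsCanonicalPartition {v : ℕ} (G : SimpleGraph v) (λ₁ λ₂ m n : ℕ)
         (cls : Fin v → Fin m) : Set where
  field
    classSize : ∀ (i : Fin m) → count (λ x → cls x == i) ≡ n
    sameClass : ∀ x y → x ≢ y → cls x ≡ cls y → commonNbrs G x y ≡ λ₁
    diffClass : ∀ x y → cls x ≢ cls y → commonNbrs G x y ≡ λ₂

record IsDDG {v : ℕ} (G : SimpleGraph v) (k λ₁ λ₂ m n : ℕ)
         (cls : Fin v → Fin m) : Set where
  field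
    vertices  : v ≡ m * n
    regular   : ∀ x → degree G x ≡ k
    canonical : IsCanonicalPartition G λ₁ λ₂ m n cls

nbrsIn : ∀ {v m} → SimpleGraph v → (Fin v → Fin m) → Fin v → Fin m → ℕ
nbrsIn G cls x j = count (λ y → adj G x y ∧ (cls y == j))

-- "after numbering the classes by σ (new class i = old class σ i), the
-- quotient matrix is R": every vertex of class σ i has exactly R i j
-- neighbours in class σ j
HasQuotientMatrix : ∀ {v m} → SimpleGraph v → (Fin v → Fin m) →
                    Permutation′ m → (Fin m → Fin m → ℕ) → Set
HasQuotientMatrix G cls σ R =
  ∀ i j x → cls x ≡ σ ⟨$⟩ʳ i → nbrsIn G cls x (σ ⟨$⟩ʳ j) ≡ R i j

R₁ : ℕ → Fin 4 → Fin 4 → ℕ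
R₁ n zero zero = n ∸ 1
R₁ n (suc zero) (suc zero) = n ∸ 1
R₁ n (suc (suc zero)) (suc (suc zero)) = n ∸ 1
R₁ n (suc (suc (suc zero))) (suc (suc (suc zero))) = n ∸ 1
R₁ n _ _ = 1

R₂ : ℕ → Fin 4 → Fin 4 → ℕ
R₂ n zero (suc zero) = n ∸ 1
R₂ n (suc zero) zero = n ∸ 1
R₂ n (suc (suc zero)) (suc (suc zero)) = n ∸ 1
R₂ n (suc (suc (suc zero))) (suc (suc (suc zero))) = n ∸ 1
R₂ n _ _ = 1

R₃ : ℕ → Fin 4 → Fin 4 → ℕ
R₃ n zero (suc zero) = n ∸ 1
R₃ n (suc zero) zero = n ∸ 1
R₃ n (suc (suc zero)) (suc (suc (suc zero))) = n ∸ 1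
R₃ n (suc (suc (suc zero))) (suc (suc zero)) = n ∸ 1
R₃ n _ _ = 1

-- The adjacency matrix A of a divisible design graph satisfies A² = kI + λ₁(K − I) + λ₂(J − K),
-- where K is the indicator matrix of "same class".  Multiplying by A and using that A³ is
-- symmetric shows that (λ₁ − λ₂) times the number of neighbours of x in the class of y is
-- symmetric in x and y, so the partition is equitable with a symmetric quotient matrix R.
-- Multiplying instead by K gives, for every row of R, Σⱼ rᵢⱼ = k and Σⱼ rᵢⱼ² = k + λ₁(n − 1).
-- With t = n − 1 these read Σ r = t + 3 and Σ r² = t² + 3, which for t ≥ 8 force the row to be
-- t, 1, 1, 1 in some order.  By symmetry of R the position of t in row i is an involution of the
-- four classes, and up to renumbering the involutions of a 4-set are the identity, a
-- transposition and a product of two disjoint transpositions: these give R₁, R₂ and R₃.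
module Submission where

open import Defs hiding (sym)
open import Data.Bool using (Bool; true; false; _∧_; if_then_else_)
open import Data.Empty using (⊥-elim)
open import Data.Fin using (Fin; zero; suc; punchOut) renaming (_≟_ to _≟ᶠ_)
open import Data.Fin.Patterns using (0F; 1F; 2F; 3F)
open import Data.Fin.Permutation using (Permutation′; _⟨$⟩ʳ_; _⟨$⟩ˡ_; id; transpose; _∘ₚ_; inverseˡ)
open import Data.Fin.Properties using (any?; all?; punchIn-punchOut)
open import Data.List using (List; _∷_; [])
open import Data.List.Relation.Unary.Any as Any using (Any; satisfied)
open import Data.Nat using (ℕ; zero; suc; _+_; _*_; _∸_; _≤_; _<_; z≤n; s≤s; _≤?_; ∣_-_∣)
open import Data.Nat.Properties
open import Algebra.Properties.CommutativeSemigroup *-commutativeSemigroup using (x∙yz≈y∙xz)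
open import Algebra.Properties.Semiring.Sum +-*-semiring
  using (sum; sum-cong-≗; sum-replicate-zero; ∑-distrib-+; ∑-comm; sum-remove; *-distribˡ-sum; *-distribʳ-sum)
open import Data.Nat.Tactic.RingSolver using (solve-∀; solve)
open import Data.Product using (∃; _,_; proj₁; proj₂; map₂)
open import Data.Sum as Sum using (_⊎_; reduce)
open import Data.Unit using (tt)
open import Data.Vec.Functional as V using (removeAt)
open import Function using (_∘_)
open import Relation.Binary.Definitions using (tri<; tri≈; tri>)
open import Relation.Binary.PropositionalEquality
open import Relation.Nullary using (Dec; yes; no; contradiction; _→-dec_; _⊎-dec_)
open import Relation.Nullary.Decidable using (toWitness)

⟦_⟧ : Bool → ℕ
⟦ true ⟧  = 1
⟦ false ⟧ = 0

⟦∧⟧ : ∀ a b → ⟦ a ∧ b ⟧ ≡ ⟦ a ⟧ * ⟦ b ⟧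
⟦∧⟧ true  b = sym (+-identityʳ ⟦ b ⟧)
⟦∧⟧ false b = refl

⟦⟧-idem : ∀ a → ⟦ a ⟧ * ⟦ a ⟧ ≡ ⟦ a ⟧
⟦⟧-idem true  = refl
⟦⟧-idem false = refl

count≡sum : ∀ {v} (P : Fin v → Bool) → count P ≡ sum (λ i → ⟦ P i ⟧)
count≡sum {zero}  P = refl
count≡sum {suc v} P with P zero
... | true  = cong suc (count≡sum (P ∘ suc))
... | false = count≡sum (P ∘ suc)

count-pos : ∀ {v} (P : Fin v → Bool) → 0 < count P → ∃ λ x → P x ≡ true
count-pos {zero}  P ()
count-pos {suc v} P pos with P zero in eq
... | true  = zero , eq
... | false = let x , Px = count-pos (P ∘ suc) pos in suc x , Px

==-refl : ∀ {m} (i : Fin m) → (i == i) ≡ true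
==-refl zero    = refl
==-refl (suc i) = ==-refl i

==-≢ : ∀ {m} {i j : Fin m} → i ≢ j → (i == j) ≡ false
==-≢ {i = zero}  {zero}  i≢j = contradiction refl i≢j
==-≢ {i = zero}  {suc j} i≢j = refl
==-≢ {i = suc i} {zero}  i≢j = refl
==-≢ {i = suc i} {suc j} i≢j = ==-≢ (i≢j ∘ cong suc)

==-sound : ∀ {m} {i j : Fin m} → (i == j) ≡ true → i ≡ j
==-sound {i = zero}  {zero}  _  = refl
==-sound {i = suc i} {suc j} eq = cong suc (==-sound eq)

==-sym : ∀ {m} (i j : Fin m) → (i == j) ≡ (j == i)
==-sym zero    zero    = refl
==-sym zero    (suc j) = refl
==-sym (suc i) zero    = refl
==-sym (suc i) (suc j) = ==-sym i j

==-permute : ∀ {m} (σ : Permutation′ m) a b → ((σ ⟨$⟩ʳ a) == (σ ⟨$⟩ʳ b)) ≡ (a == b)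
==-permute σ a b with a ≟ᶠ b
... | yes refl = trans (==-refl (σ ⟨$⟩ʳ a)) (sym (==-refl a))
... | no a≢b   = trans (==-≢ (a≢b ∘ σ-injective)) (sym (==-≢ a≢b))
  where
  σ-injective : σ ⟨$⟩ʳ a ≡ σ ⟨$⟩ʳ b → a ≡ b
  σ-injective e = trans (sym (inverseˡ σ)) (trans (cong (σ ⟨$⟩ˡ_) e) (inverseˡ σ))

δ : ∀ {m} → Fin m → Fin m → ℕ
δ i j = ⟦ i == j ⟧

sum-δ : ∀ {v} (f : Fin v → ℕ) y → sum (λ z → f z * δ z y) ≡ f y
sum-δ {suc v} f zero = begin
  f zero * 1 + sum (λ z → f (suc z) * 0)
    ≡⟨ cong₂ _+_ (*-identityʳ (f zero)) (sum-cong-≗ (*-zeroʳ ∘ f ∘ suc)) ⟩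
  f zero + sum {v} (λ _ → 0)
    ≡⟨ cong (f zero +_) (sum-replicate-zero v) ⟩
  f zero + 0
    ≡⟨ +-identityʳ (f zero) ⟩
  f zero
    ∎
  where open ≡-Reasoning
sum-δ {suc v} f (suc y) =
  trans (cong (_+ sum (λ z → f (suc z) * δ z y)) (*-zeroʳ (f zero))) (sum-δ (f ∘ suc) y)

sum-scale : ∀ {v} c (f : Fin v → ℕ) → sum (λ z → c * f z) ≡ c * sum f
sum-scale c f = sym (*-distribˡ-sum c f)

sum-+₃ : ∀ {v} (f g h : Fin v → ℕ) → sum (λ z → f z + g z + h z) ≡ sum f + sum g + sum h
sum-+₃ f g h = trans (∑-distrib-+ (λ z → f z + g z) h) (cong (_+ sum h) (∑-distrib-+ f g))

sum-ones : ∀ m → sum {m} (λ _ → 1) ≡ m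
sum-ones zero    = refl
sum-ones (suc m) = cong suc (sum-ones m)

sum-mono-≤ : ∀ {v} {f g : Fin v → ℕ} → (∀ i → f i ≤ g i) → sum f ≤ sum g
sum-mono-≤ {zero}  f≤g = z≤n
sum-mono-≤ {suc v} f≤g = +-mono-≤ (f≤g zero) (sum-mono-≤ (f≤g ∘ suc))

sum≡0 : ∀ {v} (f : Fin v → ℕ) → sum f ≡ 0 → ∀ i → f i ≡ 0
sum≡0 f eq zero    = m+n≡0⇒m≡0 (f zero) eq
sum≡0 f eq (suc i) = sum≡0 (f ∘ suc) (m+n≡0⇒n≡0 (f zero) eq) i

Matrix : ℕ → Set
Matrix v = Fin v → Fin v → ℕ

IsSymmetric : ∀ {v} → Matrix v → Set
IsSymmetric M = ∀ x y → M x y ≡ M y x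

infixl 7 _⋆_
_⋆_ : ∀ {v} → Matrix v → Matrix v → Matrix v
(M ⋆ N) x y = sum (λ z → M x z * N z y)

⋆-assoc : ∀ {v} (M N P : Matrix v) x y → (M ⋆ N ⋆ P) x y ≡ (M ⋆ (N ⋆ P)) x y
⋆-assoc M N P x y = begin
  sum (λ w → sum (λ z → M x z * N z w) * P w y)
    ≡⟨ sum-cong-≗ (λ w → *-distribʳ-sum (P w y) (λ z → M x z * N z w)) ⟩
  sum (λ w → sum (λ z → M x z * N z w * P w y))
    ≡⟨ ∑-comm (λ w z → M x z * N z w * P w y) ⟩
  sum (λ z → sum (λ w → M x z * N z w * P w y))
    ≡⟨ sum-cong-≗ (λ z → sum-cong-≗ (λ w → *-assoc (M x z) (N z w) (P w y))) ⟩
  sum (λ z → sum (λ w → M x z * (N z w * P w y)))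
    ≡⟨ sum-cong-≗ (λ z → sum-scale (M x z) (λ w → N z w * P w y)) ⟩
  sum (λ z → M x z * sum (λ w → N z w * P w y))
    ∎
  where open ≡-Reasoning

⋆-transpose : ∀ {v} {M N : Matrix v} → IsSymmetric M → IsSymmetric N → ∀ x y → (M ⋆ N) x y ≡ (N ⋆ M) y x
⋆-transpose {M = M} {N} M-sym N-sym x y =
  sum-cong-≗ (λ z → trans (*-comm (M x z) (N z y)) (cong₂ _*_ (N-sym z y) (M-sym x z)))

⋆-cube-sym : ∀ {v} {M : Matrix v} → IsSymmetric M → IsSymmetric (M ⋆ (M ⋆ M))
⋆-cube-sym {M = M} M-sym x y = trans (⋆-transpose M-sym (⋆-transpose M-sym M-sym) x y) (⋆-assoc M M M y x)

-- Divisible design graphs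

linear-solution-unique : ∀ {P Q λ₁ λ₂ s s'} → λ₂ < λ₁ →
  P + λ₂ * s ≡ Q + λ₁ * s → P + λ₂ * s' ≡ Q + λ₁ * s' → s ≡ s'
linear-solution-unique {P} {Q} {_} {λ₂} {s} {s'} λ₂<λ₁ e e' with o , refl ← m≤n⇒∃[o]m+o≡n λ₂<λ₁ =
  sym (*-cancelˡ-≡ s' s (suc o) (+-cancelˡ-≡ (P + Q + λ₂ * s + λ₂ * s') _ _ (begin
    P + Q + λ₂ * s + λ₂ * s' + suc o * s'              ≡⟨ solve (P ∷ Q ∷ λ₂ ∷ o ∷ s ∷ s' ∷ []) ⟩
    (P + λ₂ * s) + (Q + (suc λ₂ + o) * s')             ≡⟨ cong (_+ (Q + (suc λ₂ + o) * s')) e ⟩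
    (Q + (suc λ₂ + o) * s) + (Q + (suc λ₂ + o) * s')   ≡⟨ cong ((Q + (suc λ₂ + o) * s) +_) (sym e') ⟩
    (Q + (suc λ₂ + o) * s) + (P + λ₂ * s')             ≡⟨ solve (P ∷ Q ∷ λ₂ ∷ o ∷ s ∷ s' ∷ []) ⟩
    P + Q + λ₂ * s + λ₂ * s' + suc o * s               ∎)))
  where open ≡-Reasoning

module DivisibleDesignGraph {v k λ₁ λ₂ m n} {G : SimpleGraph v} {cls : Fin v → Fin m}
                            (ddg : IsDDG G k λ₁ λ₂ m n cls) where

  open IsDDG ddg
  open IsCanonicalPartition canonical

  A : Matrix v
  A x y = ⟦ adj G x y ⟧

  K : Matrix v
  K x y = ⟦ cls x == cls y ⟧

  N : Fin v → Fin m → ℕ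
  N = nbrsIn G cls

  A-sym : IsSymmetric A
  A-sym x y = cong ⟦_⟧ (SimpleGraph.sym G x y)

  K-sym : IsSymmetric K
  K-sym x y = cong ⟦_⟧ (==-sym (cls x) (cls y))

  sum-A : ∀ x → sum (A x) ≡ k
  sum-A x = trans (sym (count≡sum (adj G x))) (regular x)

  sum-K : ∀ x → sum (K x) ≡ n
  sum-K x = trans (sum-cong-≗ (K-sym x)) (trans (sym (count≡sum (λ z → cls z == cls x))) (classSize (cls x)))

  N≡sum : ∀ x j → N x j ≡ sum (λ y → A x y * ⟦ cls y == j ⟧)
  N≡sum x j = trans (count≡sum (λ y → adj G x y ∧ (cls y == j)))
                    (sum-cong-≗ (λ y → ⟦∧⟧ (adj G x y) (cls y == j)))

  commonNbrs≡A² : ∀ x y → commonNbrs G x y ≡ (A ⋆ A) x y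
  commonNbrs≡A² x y = trans (count≡sum (λ z → adj G x z ∧ adj G y z))
    (sum-cong-≗ (λ z → trans (⟦∧⟧ (adj G x z) (adj G y z)) (cong (A x z *_) (A-sym y z))))

  A²-diag : ∀ x → (A ⋆ A) x x ≡ k
  A²-diag x = trans (sum-cong-≗ (λ z → trans (cong (A x z *_) (A-sym z x)) (⟦⟧-idem (adj G x z)))) (sum-A x)

  A²-identity : ∀ w z y →
    w * (A ⋆ A) z y + λ₁ * (w * δ z y) + λ₂ * (w * K z y) ≡ k * (w * δ z y) + λ₂ * w + λ₁ * (w * K z y)
  A²-identity w z y with z ≟ᶠ y
  ... | yes refl rewrite ==-refl z | ==-refl (cls z) | A²-diag z = solve (w ∷ k ∷ λ₁ ∷ λ₂ ∷ [])
  ... | no z≢y with cls z ≟ᶠ cls y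
  ...   | yes same rewrite ==-≢ z≢y | same | ==-refl (cls y)
                       | trans (sym (commonNbrs≡A² z y)) (sameClass z y z≢y same)
                       = solve (w ∷ k ∷ λ₁ ∷ λ₂ ∷ [])
  ...   | no diff  rewrite ==-≢ z≢y | ==-≢ diff | trans (sym (commonNbrs≡A² z y)) (diffClass z y diff)
                       = solve (w ∷ k ∷ λ₁ ∷ λ₂ ∷ [])

  weighted-A²-identity : ∀ (w : Fin v → ℕ) y →
    let wA² = λ z → w z * (A ⋆ A) z y ; wδ = λ z → w z * δ z y ; wK = λ z → w z * K z y in
    sum wA² + λ₁ * sum wδ + λ₂ * sum wK ≡ k * sum wδ + λ₂ * sum w + λ₁ * sum wK
  weighted-A²-identity w y = begin
    sum wA² + λ₁ * sum wδ + λ₂ * sum wK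
      ≡⟨ cong₂ (λ a b → sum wA² + a + b) (sym (sum-scale λ₁ wδ)) (sym (sum-scale λ₂ wK)) ⟩
    sum wA² + sum (λ z → λ₁ * wδ z) + sum (λ z → λ₂ * wK z)
      ≡⟨ sym (sum-+₃ wA² _ _) ⟩
    sum (λ z → wA² z + λ₁ * wδ z + λ₂ * wK z)
      ≡⟨ sum-cong-≗ (λ z → A²-identity (w z) z y) ⟩
    sum (λ z → k * wδ z + λ₂ * w z + λ₁ * wK z)
      ≡⟨ sum-+₃ (λ z → k * wδ z) _ _ ⟩
    sum (λ z → k * wδ z) + sum (λ z → λ₂ * w z) + sum (λ z → λ₁ * wK z)
      ≡⟨ cong₂ _+_ (cong₂ _+_ (sum-scale k wδ) (sum-scale λ₂ w)) (sum-scale λ₁ wK) ⟩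
    k * sum wδ + λ₂ * sum w + λ₁ * sum wK
      ∎
    where
    open ≡-Reasoning
    wA² = λ z → w z * (A ⋆ A) z y
    wδ = λ z → w z * δ z y
    wK = λ z → w z * K z y

  A³-identity : ∀ x y →
    (A ⋆ (A ⋆ A)) x y + λ₁ * A x y + λ₂ * N x (cls y) ≡ k * A x y + λ₂ * k + λ₁ * N x (cls y)
  A³-identity x y = begin
    (A ⋆ (A ⋆ A)) x y + λ₁ * A x y + λ₂ * N x (cls y)
      ≡⟨ cong₂ (λ a s → (A ⋆ (A ⋆ A)) x y + λ₁ * a + λ₂ * s) (sym (sum-δ (A x) y)) (N≡sum x (cls y))
       ⟩
    (A ⋆ (A ⋆ A)) x y + λ₁ * sum Aδ + λ₂ * sum AK
      ≡⟨ weighted-A²-identity (A x) y ⟩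
    k * sum Aδ + λ₂ * sum (A x) + λ₁ * sum AK
      ≡⟨ cong₂ (λ a s → k * a + λ₂ * s + λ₁ * sum AK) (sum-δ (A x) y) (sum-A x) ⟩
    k * A x y + λ₂ * k + λ₁ * sum AK
      ≡⟨ cong (λ s → k * A x y + λ₂ * k + λ₁ * s) (sym (N≡sum x (cls y))) ⟩
    k * A x y + λ₂ * k + λ₁ * N x (cls y)
      ∎
    where
    open ≡-Reasoning
    Aδ = λ z → A x z * δ z y
    AK = λ z → A x z * K z y

  equitable : λ₂ < λ₁ → ∀ x y → N x (cls y) ≡ N y (cls x)
  equitable λ₂<λ₁ x y = linear-solution-unique λ₂<λ₁ (A³-identity x y)
    (subst₂ (λ c a → c + λ₁ * a + λ₂ * N y (cls x) ≡ k * a + λ₂ * k + λ₁ * N y (cls x))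
            (⋆-cube-sym A-sym y x) (A-sym y x) (A³-identity y x))

  sum-by-class : ∀ x (f : Fin m → ℕ) → sum (λ w → A x w * f (cls w)) ≡ sum (λ l → N x l * f l)
  sum-by-class x f = begin
    sum (λ w → A x w * f (cls w))
      ≡⟨ sum-cong-≗ (λ w → cong (A x w *_) (sym (sum-δ f (cls w)))) ⟩
    sum (λ w → A x w * sum (λ l → f l * δ l (cls w)))
      ≡⟨ sum-cong-≗ (λ w → sym (sum-scale (A x w) (λ l → f l * δ l (cls w)))) ⟩
    sum (λ w → sum (λ l → A x w * (f l * δ l (cls w))))
      ≡⟨ ∑-comm (λ w l → A x w * (f l * δ l (cls w))) ⟩
    sum (λ l → sum (λ w → A x w * (f l * δ l (cls w))))
      ≡⟨ sum-cong-≗ (λ l → sum-cong-≗ (λ w → regroup w l)) ⟩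
    sum (λ l → sum (λ w → f l * (A x w * ⟦ cls w == l ⟧)))
      ≡⟨ sum-cong-≗ (λ l → sum-scale (f l) (λ w → A x w * ⟦ cls w == l ⟧)) ⟩
    sum (λ l → f l * sum (λ w → A x w * ⟦ cls w == l ⟧))
      ≡⟨ sum-cong-≗ (λ l → cong (f l *_) (sym (N≡sum x l))) ⟩
    sum (λ l → f l * N x l)
      ≡⟨ sum-cong-≗ (λ l → *-comm (f l) (N x l)) ⟩
    sum (λ l → N x l * f l)
      ∎
    where
    open ≡-Reasoning
    regroup : ∀ w l → A x w * (f l * δ l (cls w)) ≡ f l * (A x w * ⟦ cls w == l ⟧)
    regroup w l = trans (x∙yz≈y∙xz (A x w) (f l) (δ l (cls w)))
                        (cong (λ b → f l * (A x w * ⟦ b ⟧)) (==-sym l (cls w)))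

  sum-N : ∀ x → sum (N x) ≡ k
  sum-N x = begin
    sum (N x)               ≡⟨ sum-cong-≗ (λ l → sym (*-identityʳ (N x l))) ⟩
    sum (λ l → N x l * 1)   ≡⟨ sym (sum-by-class x (λ _ → 1)) ⟩
    sum (λ w → A x w * 1)   ≡⟨ sum-cong-≗ (λ w → *-identityʳ (A x w)) ⟩
    sum (A x)               ≡⟨ sum-A x ⟩
    k                       ∎
    where open ≡-Reasoning

  K⋆A≡N : ∀ x w → (K ⋆ A) x w ≡ N w (cls x)
  K⋆A≡N x w = trans (sum-cong-≗ (λ z → trans (*-comm (K x z) (A z w)) (cong₂ _*_ (A-sym z w) (K-sym x z))))
                    (sym (N≡sum w (cls x)))

  sum-N² : λ₂ < λ₁ → ∀ x → sum (λ l → N x l * N x l) + λ₁ ≡ k + λ₁ * n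
  sum-N² λ₂<λ₁ x = +-cancelʳ-≡ (λ₂ * n) _ _ (begin
    sum N² + λ₁ + λ₂ * n
      ≡⟨ cong₂ (λ a b → a + b + λ₂ * n) (sym KA²≡N²) (sym (trans (cong (λ₁ *_) sum-Kδ) (*-identityʳ λ₁)))
       ⟩
    sum KA² + λ₁ * sum Kδ + λ₂ * n
      ≡⟨ cong (λ b → sum KA² + λ₁ * sum Kδ + λ₂ * b) (sym sum-KK) ⟩
    sum KA² + λ₁ * sum Kδ + λ₂ * sum KK
      ≡⟨ weighted-A²-identity (K x) x ⟩
    k * sum Kδ + λ₂ * sum (K x) + λ₁ * sum KK
      ≡⟨ cong₂ (λ a b → k * a + λ₂ * b + λ₁ * sum KK) sum-Kδ (sum-K x) ⟩
    k * 1 + λ₂ * n + λ₁ * sum KK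
      ≡⟨ cong (λ b → k * 1 + λ₂ * n + λ₁ * b) sum-KK ⟩
    k * 1 + λ₂ * n + λ₁ * n
      ≡⟨ solve (k ∷ λ₁ ∷ λ₂ ∷ n ∷ []) ⟩
    k + λ₁ * n + λ₂ * n
      ∎)
    where
    open ≡-Reasoning
    N² = λ l → N x l * N x l
    KA² = λ z → K x z * (A ⋆ A) z x
    Kδ = λ z → K x z * δ z x
    KK = λ z → K x z * K z x

    KA²≡N² : sum KA² ≡ sum N²
    KA²≡N² = begin
      sum KA²                           ≡⟨ sym (⋆-assoc K A A x x) ⟩
      sum (λ w → (K ⋆ A) x w * A w x)   ≡⟨ sum-cong-≗ (λ w → cong₂ _*_ (K⋆A≡N x w) (A-sym w x)) ⟩
      sum (λ w → N w (cls x) * A x w)   ≡⟨ sum-cong-≗ (λ w → cong (_* A x w) (equitable λ₂<λ₁ w x)) ⟩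
      sum (λ w → N x (cls w) * A x w)   ≡⟨ sum-cong-≗ (λ w → *-comm (N x (cls w)) (A x w)) ⟩
      sum (λ w → A x w * N x (cls w))   ≡⟨ sum-by-class x (N x) ⟩
      sum N²                            ∎

    sum-Kδ : sum Kδ ≡ 1
    sum-Kδ = trans (sum-δ (K x) x) (cong ⟦_⟧ (==-refl (cls x)))

    sum-KK : sum KK ≡ n
    sum-KK = trans (sum-cong-≗ (λ z → trans (cong (K x z *_) (K-sym z x)) (⟦⟧-idem (cls x == cls z)))) (sum-K x)

  module Quotient (λ₂<λ₁ : λ₂ < λ₁) (0<n : 0 < n) where

    representative : ∀ i → ∃ λ x → cls x ≡ i
    representative i = map₂ ==-sound (count-pos (λ x → cls x == i) (subst (0 <_) (sym (classSize i)) 0<n))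

    rep : Fin m → Fin v
    rep i = proj₁ (representative i)

    cls-rep : ∀ i → cls (rep i) ≡ i
    cls-rep i = proj₂ (representative i)

    Q : Matrix m
    Q i j = N (rep i) j

    N-classwise : ∀ {x y} j → cls x ≡ cls y → N x j ≡ N y j
    N-classwise {x} {y} j cx≡cy = begin
      N x j                ≡⟨ cong (N x) (cls-rep j) ⟨
      N x (cls (rep j))    ≡⟨ equitable λ₂<λ₁ x (rep j) ⟩
      N (rep j) (cls x)    ≡⟨ cong (N (rep j)) cx≡cy ⟩
      N (rep j) (cls y)    ≡⟨ equitable λ₂<λ₁ (rep j) y ⟩
      N y (cls (rep j))    ≡⟨ cong (N y) (cls-rep j) ⟩
      N y j                ∎
      where open ≡-Reasoning

    N≡Q : ∀ x j → N x j ≡ Q (cls x) j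
    N≡Q x j = N-classwise j (sym (cls-rep (cls x)))

    Q-sym : IsSymmetric Q
    Q-sym i j = begin
      N (rep i) j                ≡⟨ cong (N (rep i)) (cls-rep j) ⟨
      N (rep i) (cls (rep j))    ≡⟨ equitable λ₂<λ₁ (rep i) (rep j) ⟩
      N (rep j) (cls (rep i))    ≡⟨ cong (N (rep j)) (cls-rep i) ⟩
      N (rep j) i                ∎
      where open ≡-Reasoning

    sum-Q : ∀ i → sum (Q i) ≡ k
    sum-Q i = sum-N (rep i)

    sum-Q² : ∀ i → sum (λ j → Q i j * Q i j) + λ₁ ≡ k + λ₁ * n
    sum-Q² i = sum-N² λ₂<λ₁ (rep i)

-- Rows with Σ r = t + 3 and Σ r² = t² + 3

square-+ : ∀ a b → a * a + b * b + 2 * (a * b) ≡ (a + b) * (a + b)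
square-+ = solve-∀

sum-sq≤sq-sum : ∀ {v} (f : Fin v → ℕ) → sum (λ i → f i * f i) ≤ sum f * sum f
sum-sq≤sq-sum {zero}  f = z≤n
sum-sq≤sq-sum {suc v} f = begin
  a * a + sum (λ i → f (suc i) * f (suc i))  ≤⟨ +-monoʳ-≤ (a * a) (sum-sq≤sq-sum (f ∘ suc)) ⟩
  a * a + s * s                              ≤⟨ m≤m+n (a * a + s * s) (2 * (a * s)) ⟩
  a * a + s * s + 2 * (a * s)                ≡⟨ square-+ a s ⟩
  (a + s) * (a + s)                          ∎
  where
  open ≤-Reasoning
  a = f zero
  s = sum (f ∘ suc)

sum-sq≤bound*sum : ∀ {v} c (f : Fin v → ℕ) → (∀ i → f i ≤ c) → sum (λ i → f i * f i) ≤ c * sum f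
sum-sq≤bound*sum c f f≤c =
  ≤-trans (sum-mono-≤ (λ i → *-monoˡ-≤ (f i) (f≤c i))) (≤-reflexive (sum-scale c f))

m*m+1≡2m+∣m-1∣² : ∀ a → a * a + 1 ≡ 2 * a + ∣ a - 1 ∣ * ∣ a - 1 ∣
m*m+1≡2m+∣m-1∣² zero    = refl
m*m+1≡2m+∣m-1∣² (suc b) rewrite ∣-∣-identityʳ b = solve (b ∷ [])

-- Σ (gᵢ − 1)² = Σ gᵢ² − 2 Σ gᵢ + m vanishes.
sum≡m∧sum-sq≡m⇒all≡1 : ∀ {m} (g : Fin m → ℕ) →
  sum g ≡ m → sum (λ i → g i * g i) ≡ m → ∀ i → g i ≡ 1
sum≡m∧sum-sq≡m⇒all≡1 {m} g sum-g sum-g² i =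
  ∣m-n∣≡0⇒m≡n (reduce (m*n≡0⇒m≡0∨n≡0 (dev i) (sum≡0 (λ j → dev j * dev j) sum-dev²≡0 i)))
  where
  dev = λ j → ∣ g j - 1 ∣
  open ≡-Reasoning
  sum-dev²≡0 : sum (λ j → dev j * dev j) ≡ 0
  sum-dev²≡0 = +-cancelˡ-≡ (2 * m) _ _ (begin
    2 * m + sum (λ j → dev j * dev j)
      ≡⟨ cong (λ s → 2 * s + sum (λ j → dev j * dev j)) (sym sum-g) ⟩
    2 * sum g + sum (λ j → dev j * dev j)
      ≡⟨ cong (_+ sum (λ j → dev j * dev j)) (sym (sum-scale 2 g)) ⟩
    sum (λ j → 2 * g j) + sum (λ j → dev j * dev j)
      ≡⟨ sym (∑-distrib-+ (λ j → 2 * g j) _) ⟩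
    sum (λ j → 2 * g j + dev j * dev j)
      ≡⟨ sum-cong-≗ (λ j → sym (m*m+1≡2m+∣m-1∣² (g j))) ⟩
    sum (λ j → g j * g j + 1)
      ≡⟨ ∑-distrib-+ (λ j → g j * g j) _ ⟩
    sum (λ j → g j * g j) + sum {m} (λ _ → 1)
      ≡⟨ cong₂ _+_ sum-g² (sum-ones m) ⟩
    m + m
      ≡⟨ solve (m ∷ []) ⟩
    2 * m + 0
      ∎)

2≤t⇒t²+3<[1+t]² : ∀ {t} → 2 ≤ t → t * t + 3 < suc t * suc t
2≤t⇒t²+3<[1+t]² {suc (suc w)} (s≤s (s≤s _)) = begin-strict
  (2 + w) * (2 + w) + 3                      <⟨ m<m+n _ {suc (suc (2 * w))} (s≤s z≤n) ⟩
  (2 + w) * (2 + w) + 3 + suc (suc (2 * w))  ≡⟨ solve (w ∷ []) ⟩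
  (3 + w) * (3 + w)                          ∎
  where open ≤-Reasoning

8≤t⇒[t+3]²+32<t²+3+8[t+3] : ∀ {t} → 8 ≤ t → (t + 3) * (t + 3) + 32 < t * t + 3 + 8 * (t + 3)
8≤t⇒[t+3]²+32<t²+3+8[t+3] 8≤t with w , refl ← m≤n⇒∃[o]m+o≡n 8≤t = begin-strict
  (8 + w + 3) * (8 + w + 3) + 32                <⟨ m<m+n _ {2 + 2 * w} (s≤s z≤n) ⟩
  (8 + w + 3) * (8 + w + 3) + 32 + (2 + 2 * w)  ≡⟨ solve (w ∷ []) ⟩
  (8 + w) * (8 + w) + 3 + 8 * (8 + w + 3)       ∎
  where open ≤-Reasoning

8≤t⇒3[t+3]<t²+3 : ∀ {t} → 8 ≤ t → 3 * (t + 3) < t * t + 3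
8≤t⇒3[t+3]<t²+3 8≤t with w , refl ← m≤n⇒∃[o]m+o≡n 8≤t = begin-strict
  3 * (8 + w + 3)                          <⟨ m<m+n _ {34 + 13 * w + w * w} (s≤s z≤n) ⟩
  3 * (8 + w + 3) + (34 + 13 * w + w * w)  ≡⟨ solve (w ∷ []) ⟩
  (8 + w) * (8 + w) + 3                    ∎
  where open ≤-Reasoning

square-pair-bound : ∀ {a b} → 4 ≤ a → 4 ≤ b → a * a + b * b + 8 * (a + b) ≤ (a + b) * (a + b) + 32
square-pair-bound 4≤a 4≤b with p , refl ← m≤n⇒∃[o]m+o≡n 4≤a | r , refl ← m≤n⇒∃[o]m+o≡n 4≤b = begin
  (4 + p) * (4 + p) + (4 + r) * (4 + r) + 8 * ((4 + p) + (4 + r))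
    ≤⟨ m≤m+n _ (2 * (p * r)) ⟩
  (4 + p) * (4 + p) + (4 + r) * (4 + r) + 8 * ((4 + p) + (4 + r)) + 2 * (p * r)
    ≡⟨ solve (p ∷ r ∷ []) ⟩
  ((4 + p) + (4 + r)) * ((4 + p) + (4 + r)) + 32
    ∎
  where open ≤-Reasoning

-- For s < 3 the entry a exceeds t and a² is too large; for s ≥ 4 both a and s are at least 4
-- and a² + s² is too small, which is where t ≥ 8 is needed.
pivot-rest≡3 : ∀ {t a s q} → 8 ≤ t → 4 ≤ a →
  a + s ≡ t + 3 → a * a + q ≡ t * t + 3 → q ≤ s * s → s ≡ 3
pivot-rest≡3 {t} {a} {s} {q} 8≤t 4≤a sum-eq sq-eq q≤s² with <-cmp s 3
... | tri≈ _ s≡3 _ = s≡3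
... | tri< s<3 _ _ = ⊥-elim (n≮n _ (begin-strict
  t * t + 3      <⟨ 2≤t⇒t²+3<[1+t]² (≤-trans (s≤s (s≤s z≤n)) 8≤t) ⟩
  suc t * suc t  ≤⟨ *-mono-≤ t<a t<a ⟩
  a * a          ≤⟨ m≤m+n (a * a) q ⟩
  a * a + q      ≡⟨ sq-eq ⟩
  t * t + 3      ∎))
  where
  open ≤-Reasoning
  t<a : suc t ≤ a
  t<a = +-cancelʳ-≤ 2 (suc t) a (begin
    suc t + 2  ≡⟨ +-suc t 2 ⟨
    t + 3      ≡⟨ sum-eq ⟨
    a + s      ≤⟨ +-monoʳ-≤ a (≤-pred s<3) ⟩
    a + 2      ∎)
... | tri> _ _ 3<s = ⊥-elim (n≮n _ (begin-strict
  (t + 3) * (t + 3) + 32       <⟨ 8≤t⇒[t+3]²+32<t²+3+8[t+3] 8≤t ⟩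
  t * t + 3 + 8 * (t + 3)      ≡⟨ cong₂ (λ x y → x + 8 * y) sq-eq sum-eq ⟨
  a * a + q + 8 * (a + s)      ≤⟨ +-monoˡ-≤ (8 * (a + s)) (+-monoʳ-≤ (a * a) q≤s²) ⟩
  a * a + s * s + 8 * (a + s)  ≤⟨ square-pair-bound 4≤a 3<s ⟩
  (a + s) * (a + s) + 32       ≡⟨ cong (λ x → x * x + 32) sum-eq ⟩
  (t + 3) * (t + 3) + 32       ∎))
  where open ≤-Reasoning

rowPattern : ∀ {m} → ℕ → Fin m → Fin m → ℕ
rowPattern t p j = if p == j then t else 1

row-shape : ∀ {t} (r : Fin 4 → ℕ) → 8 ≤ t → sum r ≡ t + 3 → sum (λ j → r j * r j) ≡ t * t + 3 →
            ∃ λ p → ∀ j → r j ≡ rowPattern t p j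
row-shape {t} r 8≤t sum-r sum-r² with any? (λ j → 4 ≤? r j)
... | no no-large = ⊥-elim (n≮n _ (begin-strict
  t * t + 3              ≡⟨ sum-r² ⟨
  sum (λ j → r j * r j)  ≤⟨ sum-sq≤bound*sum 3 r (λ j → ≤-pred (≰⇒> (no-large ∘ (j ,_)))) ⟩
  3 * sum r              ≡⟨ cong (3 *_) sum-r ⟩
  3 * (t + 3)            <⟨ 8≤t⇒3[t+3]<t²+3 8≤t ⟩
  t * t + 3              ∎))
  where open ≤-Reasoning
... | yes (p , 4≤rp) = p , shape
  where
  rest = removeAt r p
  sum-rest = sum-remove {i = p} r
  sum-rest² = sum-remove {i = p} (λ j → r j * r j)

  rest≡3 : sum rest ≡ 3
  rest≡3 = pivot-rest≡3 8≤t 4≤rp (trans (sym sum-rest) sum-r) (trans (sym sum-rest²) sum-r²) (sum-sq≤sq-sum rest)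

  rp≡t : r p ≡ t
  rp≡t = +-cancelʳ-≡ 3 (r p) t (trans (cong (r p +_) (sym rest≡3)) (trans (sym sum-rest) sum-r))

  rest²≡3 : sum (λ j → rest j * rest j) ≡ 3
  rest²≡3 = +-cancelˡ-≡ (t * t) _ 3 (trans (cong (λ x → x * x + _) (sym rp≡t)) (trans (sym sum-rest²) sum-r²))

  shape : ∀ j → r j ≡ rowPattern t p j
  shape j with p ≟ᶠ j
  ... | yes refl rewrite ==-refl p = rp≡t
  ... | no p≢j rewrite ==-≢ p≢j =
    trans (cong r (sym (punchIn-punchOut p≢j))) (sum≡m∧sum-sq≡m⇒all≡1 rest rest≡3 rest²≡3 (punchOut p≢j))

-- Symmetric matrices of row patterns

IsInvolution : ∀ {m} → (Fin m → Fin m) → Set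
IsInvolution p = ∀ i → p (p i) ≡ i

pattern-symmetric⇒involution : ∀ {m t} {Q : Matrix m} {p : Fin m → Fin m} → t ≢ 1 → IsSymmetric Q →
  (∀ i j → Q i j ≡ rowPattern t (p i) j) → IsInvolution p
pattern-symmetric⇒involution {t = t} {Q} {p} t≢1 Q-sym Q≡ i with p (p i) ≟ᶠ i
... | yes ppi≡i = ppi≡i
... | no  ppi≢i = contradiction (begin
  t                         ≡⟨ cong (λ b → if b then t else 1) (==-refl (p i)) ⟨
  rowPattern t (p i) (p i)  ≡⟨ Q≡ i (p i) ⟨
  Q i (p i)                 ≡⟨ Q-sym i (p i) ⟩
  Q (p i) i                 ≡⟨ Q≡ (p i) i ⟩
  rowPattern t (p (p i)) i  ≡⟨ cong (λ b → if b then t else 1) (==-≢ ppi≢i) ⟩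
  1                         ∎) t≢1
  where open ≡-Reasoning

Conjugate : ∀ {m} → (Fin m → Fin m) → Permutation′ m → (Fin m → Fin m) → Set
Conjugate p σ π = ∀ i → p (σ ⟨$⟩ʳ i) ≡ σ ⟨$⟩ʳ π i

π₁ π₂ π₃ : Fin 4 → Fin 4
π₁ i = i
π₂ = transpose 0F 1F ⟨$⟩ʳ_
π₃ = (transpose 0F 1F ∘ₚ transpose 2F 3F) ⟨$⟩ʳ_

NormalForm : (Fin 4 → Fin 4) → Permutation′ 4 → Set
NormalForm p σ = Conjugate p σ π₁ ⊎ Conjugate p σ π₂ ⊎ Conjugate p σ π₃

-- Decided by evaluation over all 4⁴ value tables; q is p tabulated so that the check applies to it.
involution-normal-form : ∀ p → IsInvolution p → ∃ (NormalForm p)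
involution-normal-form p p-inv =
  map₂ (λ {σ} → transport {σ}) (satisfied (checked (p 0F) (p 1F) (p 2F) (p 3F) q-inv))
  where
  q : Fin 4 → Fin 4
  q = p 0F V.∷ p 1F V.∷ p 2F V.∷ p 3F V.∷ V.[]

  q≗p : ∀ i → q i ≡ p i
  q≗p 0F = refl
  q≗p 1F = refl
  q≗p 2F = refl
  q≗p 3F = refl

  q-inv : IsInvolution q
  q-inv i = trans (q≗p (q i)) (trans (cong p (q≗p i)) (p-inv i))

  transport-conjugate : ∀ π {σ} → Conjugate q σ π → Conjugate p σ π
  transport-conjugate π {σ} q~π i = trans (sym (q≗p (σ ⟨$⟩ʳ i))) (q~π i)

  transport : ∀ {σ} → NormalForm q σ → NormalForm p σ
  transport {σ} = Sum.map (transport-conjugate π₁ {σ})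
                          (Sum.map (transport-conjugate π₂ {σ}) (transport-conjugate π₃ {σ}))

  conjugators : List (Permutation′ 4)
  conjugators = id ∷ transpose 1F 2F ∷ transpose 1F 3F ∷ transpose 0F 2F ∷ transpose 0F 3F
              ∷ (transpose 0F 2F ∘ₚ transpose 1F 3F) ∷ []

  conjugate? : ∀ r σ π → Dec (Conjugate r σ π)
  conjugate? r σ π = all? (λ i → r (σ ⟨$⟩ʳ i) ≟ᶠ σ ⟨$⟩ʳ π i)

  checked : ∀ a b c d → let r = a V.∷ b V.∷ c V.∷ d V.∷ V.[] in
            IsInvolution r → Any (NormalForm r) conjugators
  checked = toWitness {a? = all? λ a → all? λ b → all? λ c → all? λ d →
              let r = a V.∷ b V.∷ c V.∷ d V.∷ V.[] in
              all? (λ i → r (r i) ≟ᶠ i) →-dec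
              Any.any? (λ σ → conjugate? r σ π₁ ⊎-dec conjugate? r σ π₂ ⊎-dec conjugate? r σ π₃)
                       conjugators} tt

∀-Fin4 : ∀ {ℓ} {P : Fin 4 → Set ℓ} → P 0F → P 1F → P 2F → P 3F → ∀ i → P i
∀-Fin4 p₀ p₁ p₂ p₃ 0F = p₀
∀-Fin4 p₀ p₁ p₂ p₃ 1F = p₁
∀-Fin4 p₀ p₁ p₂ p₃ 2F = p₂
∀-Fin4 p₀ p₁ p₂ p₃ 3F = p₃

R₁≡pattern : ∀ t i j → R₁ (suc t) i j ≡ rowPattern t (π₁ i) j
R₁≡pattern t = ∀-Fin4 (∀-Fin4 refl refl refl refl) (∀-Fin4 refl refl refl refl)
                      (∀-Fin4 refl refl refl refl) (∀-Fin4 refl refl refl refl)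

R₂≡pattern : ∀ t i j → R₂ (suc t) i j ≡ rowPattern t (π₂ i) j
R₂≡pattern t = ∀-Fin4 (∀-Fin4 refl refl refl refl) (∀-Fin4 refl refl refl refl)
                      (∀-Fin4 refl refl refl refl) (∀-Fin4 refl refl refl refl)

R₃≡pattern : ∀ t i j → R₃ (suc t) i j ≡ rowPattern t (π₃ i) j
R₃≡pattern t = ∀-Fin4 (∀-Fin4 refl refl refl refl) (∀-Fin4 refl refl refl refl)
                      (∀-Fin4 refl refl refl refl) (∀-Fin4 refl refl refl refl)

Renumbered : Matrix 4 → Permutation′ 4 → Matrix 4 → Set
Renumbered Q σ R = ∀ i j → Q (σ ⟨$⟩ʳ i) (σ ⟨$⟩ʳ j) ≡ R i j

pattern-matrix-normal-form : ∀ {t} (Q : Matrix 4) → t ≢ 1 → IsSymmetric Q →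
  (∀ i → ∃ λ p → ∀ j → Q i j ≡ rowPattern t p j) →
  ∃ λ σ → Renumbered Q σ (R₁ (suc t)) ⊎ Renumbered Q σ (R₂ (suc t)) ⊎ Renumbered Q σ (R₃ (suc t))
pattern-matrix-normal-form {t} Q t≢1 Q-sym rows =
  map₂ (λ {σ} → Sum.map (renumber {σ} π₁ (R₁≡pattern t))
                        (Sum.map (renumber {σ} π₂ (R₂≡pattern t)) (renumber {σ} π₃ (R₃≡pattern t))))
       (involution-normal-form p (pattern-symmetric⇒involution {p = p} t≢1 Q-sym Q≡))
  where
  p : Fin 4 → Fin 4
  p i = proj₁ (rows i)

  Q≡ : ∀ i j → Q i j ≡ rowPattern t (p i) j
  Q≡ i = proj₂ (rows i)

  renumber : ∀ {σ} π {R : Matrix 4} →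
             (∀ i j → R i j ≡ rowPattern t (π i) j) → Conjugate p σ π → Renumbered Q σ R
  renumber {σ} π {R} R≡ σ-conj i j = begin
    Q (σ ⟨$⟩ʳ i) (σ ⟨$⟩ʳ j)                 ≡⟨ Q≡ (σ ⟨$⟩ʳ i) (σ ⟨$⟩ʳ j) ⟩
    rowPattern t (p (σ ⟨$⟩ʳ i)) (σ ⟨$⟩ʳ j)  ≡⟨ cong (λ a → rowPattern t a (σ ⟨$⟩ʳ j)) (σ-conj i) ⟩
    rowPattern t (σ ⟨$⟩ʳ π i) (σ ⟨$⟩ʳ j)    ≡⟨ cong (λ b → if b then t else 1) (==-permute σ (π i) j) ⟩
    rowPattern t (π i) j                    ≡⟨ R≡ i j ⟨
    R i j                                   ∎
    where open ≡-Reasoning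

corollary1 : ∀ (n : ℕ) → 8 < n →
    (G : SimpleGraph (4 * n)) (cls : Fin (4 * n) → Fin 4) →
    IsDDG G (n + 2) (n ∸ 2) 2 4 n cls →
    ∃ λ (σ : Permutation′ 4) →
      HasQuotientMatrix G cls σ (R₁ n) ⊎ HasQuotientMatrix G cls σ (R₂ n)
        ⊎ HasQuotientMatrix G cls σ (R₃ n)
corollary1 n 8<n G cls ddg with w , refl ← m≤n⇒∃[o]m+o≡n 8<n =
  map₂ (λ {σ} → Sum.map (realise σ) (Sum.map (realise σ) (realise σ)))
       (pattern-matrix-normal-form Q (λ ()) Q-sym row-pattern)
  where
  open DivisibleDesignGraph ddg
  open Quotient (s≤s (s≤s (s≤s z≤n))) (s≤s z≤n)

  row-pattern : ∀ i → ∃ λ p → ∀ j → Q i j ≡ rowPattern (8 + w) p j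
  row-pattern i = row-shape (Q i) (m≤m+n 8 w)
    (trans (sum-Q i) (solve (w ∷ [])))
    (+-cancelʳ-≡ (7 + w) _ _ (trans (sum-Q² i) parameters))
    where
    parameters : 9 + w + 2 + (7 + w) * (9 + w) ≡ (8 + w) * (8 + w) + 3 + (7 + w)
    parameters = solve (w ∷ [])

  realise : ∀ σ {R} → Renumbered Q σ R → HasQuotientMatrix G cls σ R
  realise σ Q≅R i j x cx = trans (N≡Q x (σ ⟨$⟩ʳ j)) (trans (cong (λ c → Q c (σ ⟨$⟩ʳ j)) cx) (Q≅R i j))
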